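{- Let $A,B\subseteq[n]$ be nonempty with $|A|=|B|$. Then there is an element $(i,j)\in N(A,B)$ such that $x_{ij}$ divides $\mathrm{lm}_\preceq(\det M(A,B))$.
   Context: $X=(x_{ij})_{1\le i,j\le n}$ is a matrix of indeterminates over a field $\mathbb K$, and $M(A,B)=(x_{ij})_{i\in A,j\in B}$. For $s\ge1$ and $A=\{a_1<\dots<a_s\}$, $B=\{b_1<\dots<b_s\}$, let $\ell$ be the least integer $0\le\ell\le s$ such that $a_{i+\ell}>b_i$ for all $1\le i\le s-\ell$. Then $N(A,B)=\{(a_{(i+\ell)\bmod s},b_i):i=1,\dots,s\}$, where $\bmod s$ takes values in $\{1,\dots,s\}$. Term order $\preceq$: let $\varphi(i,j)=\big[((2-i)n+(j-1)(n-1)-1)\bmod n^2\big]+1$, with the usual residue in $\{0,\dots,n^2-1\}$. Order the variables by $x_{ij}\preceq x_{kl}$ iff $\varphi(i,j)\le\varphi(k,l)$. Then $\preceq$ is the degree reverse lexicographic order for this variable order: $m\prec m'$ if $\deg m<\deg m'$, or if the degrees are equal and, at the $\preceq$-smallest variable where the exponents differ, $m$ has the larger exponent. $\mathrm{lm}_\preceq(f)$ is the $\preceq$-largest monomial of $f$ with nonzero coefficient. -}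

module Defs where

open import Level using (Level; _⊔_)
open import Algebra.Bundles using (CommutativeRing)
open import Data.Nat as ℕ using (ℕ; zero; suc; _∸_; _<_; _≤_; _>_; _≥_)
open import Data.Nat.DivMod using (_%_)
open import Data.Integer as ℤ using (ℤ)
open import Data.Integer.DivMod as ℤD using ()
open import Data.Fin as Fin using (Fin; toℕ; punchIn)
open import Data.Fin.Properties using (all?)
open import Data.List as List using (List; []; _∷_; allFin; concatMap; map; foldr; filter)
open import Data.Nat.ListAction using (sum)
open import Data.Product using (Σ; ∃; _×_; _,_; proj₁; proj₂)
open import Data.Sum using (_⊎_)
open import Relation.Nullary using (¬_; Dec; yes; no)
open import Relation.Binary.PropositionalEquality using (_≡_)
open import Data.Nat.Properties using () renaming (_≟_ to _≟ℕ_)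

record Field (c ℓ : Level) : Set (Level.suc (c ⊔ ℓ)) where
  field
    commRing : CommutativeRing c ℓ
  open CommutativeRing commRing public
  field
    0≉1     : ¬ (0# ≈ 1#)
    inverse : ∀ x → ¬ (x ≈ 0#) → ∃ λ y → (x * y) ≈ 1#

-- Monomials in the variables x_{ij}, i,j ∈ [n]  (Fin n is the 0-based
-- copy of [n]; the variable x_{ij} with 1-based i,j is indexed by
-- (i-1, j-1)).  A monomial is its exponent function.

Monomial : ℕ → Set
Monomial n = Fin n → Fin n → ℕ

oneM : ∀ {n} → Monomial n
oneM _ _ = 0

_·M_ : ∀ {n} → Monomial n → Monomial n → Monomial n
(m ·M m') i j = m i j ℕ.+ m' i j

varM : ∀ {n} → Fin n → Fin n → Monomial n
varM {n} i j k l with toℕ i ≟ℕ toℕ k | toℕ j ≟ℕ toℕ l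
... | yes _ | yes _ = 1
... | _         | _         = 0

_≟M_ : ∀ {n} (m m' : Monomial n) → Dec (∀ i j → m i j ≡ m' i j)
m ≟M m' = all? (λ i → all? (λ j → m i j ≟ℕ m' i j))

finSum : ∀ {n} → (Fin n → ℕ) → ℕ
finSum {n} f = sum (map f (allFin n))

deg : ∀ {n} → Monomial n → ℕ
deg m = finSum (λ i → finSum (λ j → m i j))

_∣M_ : ∀ {n} → (Fin n × Fin n) → Monomial n → Set
(i , j) ∣M m = 1 ≤ m i j

-- The variable order: φ(i,j) = [((2-i)n + (j-1)(n-1) - 1) mod n²] + 1
-- for 1-based i, j.

φ : (n : ℕ) → Fin n → Fin n → ℕ
φ (suc k) i j = suc (ℤD._%ℕ_ v (suc k ℕ.* suc k))
  where
  n' i' j' v : ℤ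
  n' = ℤ.+ suc k
  i' = ℤ.+ suc (toℕ i)
  j' = ℤ.+ suc (toℕ j)
  v = ((ℤ.+ 2 ℤ.- i') ℤ.* n') ℤ.+ ((j' ℤ.- ℤ.+ 1) ℤ.* (n' ℤ.- ℤ.+ 1)) ℤ.- ℤ.+ 1

-- Degree reverse lexicographic order w.r.t. the variable order given by φ:
-- m ≺ m' iff deg m < deg m', or the degrees agree and at the φ-smallest
-- variable where the exponents differ, m has the larger exponent.
_≺_ : ∀ {n} → Monomial n → Monomial n → Set
_≺_ {n} m m' =
  deg m < deg m' ⊎
  (deg m ≡ deg m' ×
   ∃ λ (p : Fin n × Fin n) →
     m' (proj₁ p) (proj₂ p) < m (proj₁ p) (proj₂ p) ×
     (∀ k l → φ n k l < φ n (proj₁ p) (proj₂ p) → m k l ≡ m' k l))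

_⪯_ : ∀ {n} → Monomial n → Monomial n → Set
m ⪯ m' = m ≺ m' ⊎ (∀ i j → m i j ≡ m' i j)

-- Polynomials over a field K in the x_{ij}, represented as formal sums
-- (lists) of terms  c · m ; the coefficient of a monomial collects all
-- terms with that monomial.

module Poly {c ℓ} (K : Field c ℓ) where
  open Field K

  Poly : ℕ → Set c
  Poly n = List (Carrier × Monomial n)

  coeff : ∀ {n} → Poly n → Monomial n → Carrier
  coeff []             m = 0#
  coeff ((a , m') ∷ f) m with m' ≟M m
  ... | yes _ = a + coeff f m
  ... | no  _ = coeff f m

  IsLeadingMonomial : ∀ {n} → Poly n → Monomial n → Set ℓ
  IsLeadingMonomial f m =
    ¬ (coeff f m ≈ 0#) × (∀ m' → ¬ (coeff f m' ≈ 0#) → m' ⪯ m)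

  -- Determinant of a k×k matrix whose (r,c) entry is the variable
  -- x_{E r c}, by Laplace expansion along the first row:
  --   det E = Σ_j (-1)^j x_{E 0 j} det(minor E 0 j).
  sgn : ∀ {k} → Fin k → Carrier
  sgn Fin.zero    = 1#
  sgn (Fin.suc j) = - sgn j

  det : ∀ {n} (k : ℕ) → (Fin k → Fin k → Fin n × Fin n) → Poly n
  det zero    E = (1# , oneM) ∷ []
  det (suc k) E = concatMap term (allFin (suc k))
    where
    term : Fin (suc k) → Poly _
    term j = map (λ t → (sgn j * proj₁ t ,
                         varM (proj₁ (E Fin.zero j)) (proj₂ (E Fin.zero j)) ·M proj₂ t))
                 (det k (λ r c → E (Fin.suc r) (punchIn j c)))

-- Subsets A = {a_1 < … < a_s} of [n] are given by strictly increasing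
-- maps a : Fin s → Fin n (0-based positions: a(t) = a_{t+1}).

StrictlyIncreasing : ∀ {s n} → (Fin s → Fin n) → Set
StrictlyIncreasing a = ∀ t u → t Fin.< u → a t Fin.< a u

submatrix : ∀ {s n} → (Fin s → Fin n) → (Fin s → Fin n) → Fin s → Fin s → Fin n × Fin n
submatrix a b r c = (a r , b c)

-- ℓ satisfies:  a_{i+ℓ} > b_i  for all 1 ≤ i ≤ s - ℓ  (0-based: t < s ∸ ℓ).
ShiftOK : ∀ {s n} → (Fin s → Fin n) → (Fin s → Fin n) → ℕ → Set
ShiftOK {s} a b ℓ = ∀ (t : Fin s) (u : Fin s) →
  toℕ t < s ∸ ℓ → toℕ u ≡ toℕ t ℕ.+ ℓ → toℕ (b t) < toℕ (a u)

IsShift : ∀ {s n} → (Fin s → Fin n) → (Fin s → Fin n) → ℕ → Set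
IsShift {s} a b ℓ = ℓ ≤ s × ShiftOK a b ℓ × (∀ ℓ' → ℓ' < ℓ → ¬ ShiftOK a b ℓ')

-- (i,j) ∈ N(A,B) = {(a_{(t+ℓ) mod s}, b_t) : t = 1..s} (mod s valued in
-- 1..s); 0-based: position t ↦ (a_{(t+ℓ) % s}, b_t).
-- (s ≥ 1 is built in by indexing with suc s.)
InN : ∀ {s n} → (Fin (suc s) → Fin n) → (Fin (suc s) → Fin n) → ℕ → Fin n × Fin n → Set
InN {s} a b ℓ (i , j) = ∃ λ (t : Fin (suc s)) → ∃ λ (u : Fin (suc s)) →
  toℕ u ≡ (toℕ t ℕ.+ ℓ) % suc s × a u ≡ i × b t ≡ j

{-# OPTIONS --safe #-}
module Submission where

-- Rotate the rows of M(A,B) cyclically by T + ℓ and its columns by T, where T = 0 if ℓ = 0 and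
-- otherwise T is a position at which the shift ℓ - 1 fails; then N(A,B) becomes the diagonal.
-- Unrolling A and B periodically (position t + q(s+1) carries a_t + q n), the rotated rows and
-- columns carry increasing values α_i and β_j with β_i < α_i ≤ n + β_0, and the variable in
-- position (r, c) has φ = 1 + n (n + β_c - α_r) + (n - 1 - b_c).  Hence every entry weakly
-- south-west of a diagonal entry precedes it in the variable order.  So for any other
-- transversal σ, the φ-first variable where σ and the diagonal differ cannot be a diagonal
-- variable x_{i₀i₀} missing from σ, for then σ would map {r ≥ i₀} into {r > i₀}: the diagonal
-- product is the degrevlex-largest transversal product.  As the entries are distinct variables,
-- the monomials of the determinant are exactly the transversal products, with coefficients ±1,
-- so the leading monomial is the product of the variables of N(A,B).

open import Defs
open import Level using (Level)
open import Data.Nat using (ℕ; suc)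
open import Data.Fin using (Fin)
open import Data.Product using (Σ; ∃; _×_; _,_)

open import Algebra.Bundles using (CommutativeMonoid)
import Algebra.Properties.CommutativeMonoid.Sum as CommutativeMonoidSum
open import Data.Empty using (⊥; ⊥-elim)
open import Data.Fin.Base as Fin using (toℕ; punchIn)
open import Data.Fin.Permutation as Perm using (Permutation′; _⟨$⟩ʳ_; _⟨$⟩ˡ_; permutation)
open import Data.Fin.Properties as Fin
  using (pigeonhole; any?; toℕ-injective; suc-injective; toℕ<n; toℕ-fromℕ<)
open import Data.Integer.Base as ℤ using (ℤ; +_; -[1+_]; _%ℕ_)
import Data.Integer.Properties as ℤ
open import Data.Integer.Tactic.RingSolver using (solve-∀)
open import Data.List.Base using (allFin; tabulate; map)
open import Data.List.Properties using (map-tabulate; map-cong)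
open import Data.Nat.Base as ℕ using (zero; _∸_; _≤_; _<_; z≤n; s≤s; NonZero)
open import Data.Nat.DivMod
  using (_%_; _/_; _mod_; m≡m%n+[m/n]*n; [m+kn]%n≡m%n; m<n⇒m%n≡m; n%n≡0; m*n/n≡m; m*n%n≡0;
         m<n⇒m/n≡0; +-distrib-/; /-monoˡ-≤)
open import Data.Nat.GeneralisedArithmetic using (fold)
open import Data.Nat.Induction using (<-wellFounded)
open import Data.Nat.ListAction using (sum)
import Data.Nat.Properties as ℕ
open import Algebra.Properties.CommutativeSemigroup ℕ.+-commutativeSemigroup
  using (xy∙z≈xz∙y; x∙yz≈y∙xz)
open import Data.Product using (proj₁; proj₂; ∃₂)
open import Data.Product.Properties using (≡-dec)
open import Data.Sum using (_⊎_; inj₁; inj₂)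
open import Data.Unit using (⊤; tt)
open import Function.Base using (_∘_; id)
open import Function.Definitions using (Injective)
open import Induction.WellFounded using (Acc; acc)
open import Relation.Binary.Definitions using (Tri; tri<; tri≈; tri>)
open import Relation.Binary.PropositionalEquality
  using (_≡_; _≢_; refl; sym; trans; cong; cong₂; subst; subst₂; module ≡-Reasoning)
open import Relation.Nullary using (¬_; Dec; yes; no; contradiction)
open import Relation.Nullary.Decidable using (map′; ¬?; _×-dec_; _→-dec_; decidable-stable)

private
  variable
    k m n : ℕ

-- Injective endomaps of Fin m

module _ {f : Fin m → Fin m} (f-injective : Injective _≡_ _≡_ f) where

  private
    cancel-iterates : ∀ i d {x} → fold x f (i ℕ.+ d) ≡ fold x f i → fold x f d ≡ x
    cancel-iterates zero    d eq = eq
    cancel-iterates (suc i) d eq = cancel-iterates i d (f-injective eq)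

  orbit-returns : ∀ x → ∃ λ d → fold x f (suc d) ≡ x
  orbit-returns x =
    let i , j , i<j , fᶦx≡fʲx = pigeonhole (ℕ.n<1+n m) (λ i → fold x f (toℕ i))
        d , 1+i+d≡j           = ℕ.m≤n⇒∃[o]m+o≡n i<j
        i+1+d≡j               = trans (ℕ.+-suc (toℕ i) d) 1+i+d≡j
    in d , cancel-iterates (toℕ i) (suc d)
             (trans (cong (fold x f) i+1+d≡j) (sym fᶦx≡fʲx))

  invariant-preimage : ∀ {p} (P : Fin m → Set p) {x} → P x → (∀ {y} → P y → P (f y)) →
                       ∃ λ y → P y × f y ≡ x
  invariant-preimage P {x} Px invariant =
    let d , fᵈ⁺¹x≡x = orbit-returns x in fold x f d , iterate d , fᵈ⁺¹x≡x
    where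
    iterate : ∀ d → P (fold x f d)
    iterate zero    = Px
    iterate (suc d) = invariant (iterate d)

  injective⇒surjective : ∀ y → ∃ λ x → f x ≡ y
  injective⇒surjective y =
    let x , _ , fx≡y = invariant-preimage (λ _ → ⊤) tt (λ _ → tt) in x , fx≡y

  injective⇒permutation : Permutation′ m
  injective⇒permutation = permutation f (proj₁ ∘ injective⇒surjective)
    (proj₂ ∘ injective⇒surjective) (λ x → f-injective (proj₂ (injective⇒surjective (f x))))

⟨$⟩ʳ-injective : (π : Permutation′ k) → Injective _≡_ _≡_ (π ⟨$⟩ʳ_)
⟨$⟩ʳ-injective π {x} {y} πx≡πy =
  trans (sym (Perm.inverseˡ π)) (trans (cong (π ⟨$⟩ˡ_) πx≡πy) (Perm.inverseˡ π))

-- Monomials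

Var : ℕ → Set
Var n = Fin n × Fin n

_≟ᵛ_ : (x y : Var n) → Dec (x ≡ y)
_≟ᵛ_ = ≡-dec Fin._≟_ Fin._≟_

anyVar? : ∀ {p} {P : Var n → Set p} → (∀ x → Dec (P x)) → Dec (∃ P)
anyVar? P? = map′ (λ (i , j , Pij) → (i , j) , Pij) (λ ((i , j) , Pij) → i , j , Pij)
                  (any? λ i → any? λ j → P? (i , j))

var : Var n → Monomial n
var x = varM (proj₁ x) (proj₂ x)

_at_ : Monomial n → Var n → ℕ
m at x = m (proj₁ x) (proj₂ x)

φᵛ : Var n → ℕ
φᵛ {n} x = φ n (proj₁ x) (proj₂ x)

infix 4 _≗ᴹ_
_≗ᴹ_ : Monomial n → Monomial n → Set
m ≗ᴹ m′ = ∀ i j → m i j ≡ m′ i j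

var-self : (x : Var n) → var x at x ≡ 1
var-self (i , j) with toℕ i ℕ.≟ toℕ i | toℕ j ℕ.≟ toℕ j
... | yes _  | yes _  = refl
... | no i≢i | _      = contradiction refl i≢i
... | yes _  | no j≢j = contradiction refl j≢j

var-other : {x y : Var n} → x ≢ y → var x at y ≡ 0
var-other {x = i , j} {k , l} x≢y with toℕ i ℕ.≟ toℕ k | toℕ j ℕ.≟ toℕ l
... | yes i≡k | yes j≡l =
  contradiction (cong₂ _,_ (toℕ-injective i≡k) (toℕ-injective j≡l)) x≢y
... | no _    | _       = refl
... | yes _   | no _    = refl

_÷_ : Monomial n → Var n → Monomial n
(m ÷ x) i j = m i j ∸ var x at (i , j)

∣M⇒var≤ : {x : Var n} {m : Monomial n} → x ∣M m → ∀ i j → var x at (i , j) ≤ m i j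
∣M⇒var≤ {x = x} x∣m i j with x ≟ᵛ (i , j)
... | yes refl = subst (_≤ _) (sym (var-self x)) x∣m
... | no  x≢ij = subst (_≤ _) (sym (var-other x≢ij)) z≤n

var·÷ : {x : Var n} {m : Monomial n} → x ∣M m → var x ·M (m ÷ x) ≗ᴹ m
var·÷ {x = x} {m} x∣m i j = ℕ.m+[n∸m]≡n (∣M⇒var≤ {x = x} {m} x∣m i j)

÷-var· : (x : Var n) (m : Monomial n) → (var x ·M m) ÷ x ≗ᴹ m
÷-var· x m i j = ℕ.m+n∸m≡n (var x at (i , j)) (m i j)

prodVars : (Fin k → Var n) → Monomial n
prodVars {zero}  v = oneM
prodVars {suc k} v = var (v Fin.zero) ·M prodVars (v ∘ Fin.suc)

prodVars-cong : {v w : Fin k → Var n} → (∀ r → v r ≡ w r) → prodVars v ≗ᴹ prodVars w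
prodVars-cong {zero}  v≡w i j = refl
prodVars-cong {suc k} v≡w i j =
  cong₂ (λ x e → var x at (i , j) ℕ.+ e) (v≡w Fin.zero) (prodVars-cong (v≡w ∘ Fin.suc) i j)

prodVars-∈⇒pos : (v : Fin k → Var n) (r : Fin k) {x : Var n} → v r ≡ x → 1 ≤ prodVars v at x
prodVars-∈⇒pos v Fin.zero    refl =
  ℕ.≤-trans (ℕ.≤-reflexive (sym (var-self (v Fin.zero)))) (ℕ.m≤m+n _ _)
prodVars-∈⇒pos v (Fin.suc r) vr≡x =
  ℕ.≤-trans (prodVars-∈⇒pos (v ∘ Fin.suc) r vr≡x) (ℕ.m≤n+m _ _)

prodVars-∉⇒0 : (v : Fin k → Var n) {x : Var n} → (∀ r → v r ≢ x) → prodVars v at x ≡ 0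
prodVars-∉⇒0 {zero}  v x∉v = refl
prodVars-∉⇒0 {suc k} v x∉v =
  cong₂ ℕ._+_ (var-other (x∉v Fin.zero)) (prodVars-∉⇒0 (v ∘ Fin.suc) (x∉v ∘ Fin.suc))

prodVars-pos⇒∈ : (v : Fin k → Var n) {x : Var n} → 1 ≤ prodVars v at x → ∃ λ r → v r ≡ x
prodVars-pos⇒∈ {zero}  v ()
prodVars-pos⇒∈ {suc k} v {x} pos with v Fin.zero ≟ᵛ x
... | yes v₀≡x = Fin.zero , v₀≡x
... | no  v₀≢x =
  let r , vr≡x = prodVars-pos⇒∈ (v ∘ Fin.suc)
                   (subst (λ e → 1 ≤ e ℕ.+ prodVars (v ∘ Fin.suc) at x) (var-other v₀≢x) pos)
  in Fin.suc r , vr≡x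

prodVars-≤1 : {v : Fin k → Var n} → Injective _≡_ _≡_ v → ∀ x → prodVars v at x ≤ 1
prodVars-≤1 {zero}          v-inj x = z≤n
prodVars-≤1 {suc k} {v = v} v-inj x with v Fin.zero ≟ᵛ x
... | yes refl = ℕ.≤-reflexive (cong₂ ℕ._+_ (var-self x)
                   (prodVars-∉⇒0 (v ∘ Fin.suc) λ r v₁₊ᵣ≡v₀ → Fin.0≢1+n (v-inj (sym v₁₊ᵣ≡v₀))))
... | no  v₀≢x = subst (_≤ 1) (sym (cong (ℕ._+ prodVars (v ∘ Fin.suc) at x) (var-other v₀≢x)))
                   (prodVars-≤1 (suc-injective ∘ v-inj) x)

≤1-≡ : ∀ {a b} → a ≤ 1 → b ≤ 1 → (1 ≤ a → 1 ≤ b) → (1 ≤ b → 1 ≤ a) → a ≡ b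
≤1-≡ {0}           {0}           _        _ _   _   = refl
≤1-≡ {0}           {1}           _        _ _   b⇒a = contradiction (b⇒a ℕ.≤-refl) λ ()
≤1-≡ {1}           {0}           _        _ a⇒b _   = contradiction (a⇒b ℕ.≤-refl) λ ()
≤1-≡ {1}           {1}           _        _ _   _   = refl
≤1-≡ {suc (suc _)} {_}           (s≤s ()) _ _   _
≤1-≡ {_}           {suc (suc _)} _ (s≤s ())  _   _

prodVars-reindex : {v : Fin k → Var n} → Injective _≡_ _≡_ v → (ρ : Permutation′ k) →
                   prodVars (v ∘ (ρ ⟨$⟩ʳ_)) ≗ᴹ prodVars v
prodVars-reindex {v = v} v-inj ρ i j =
  ≤1-≡ (prodVars-≤1 (⟨$⟩ʳ-injective ρ ∘ v-inj) (i , j)) (prodVars-≤1 v-inj (i , j)) to from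
  where
  to : 1 ≤ prodVars (v ∘ (ρ ⟨$⟩ʳ_)) i j → 1 ≤ prodVars v i j
  to pos = let r , vρr≡ij = prodVars-pos⇒∈ (v ∘ (ρ ⟨$⟩ʳ_)) pos
           in prodVars-∈⇒pos v (ρ ⟨$⟩ʳ r) vρr≡ij
  from : 1 ≤ prodVars v i j → 1 ≤ prodVars (v ∘ (ρ ⟨$⟩ʳ_)) i j
  from pos = let r , vr≡ij = prodVars-pos⇒∈ v pos
             in prodVars-∈⇒pos (v ∘ (ρ ⟨$⟩ʳ_)) (ρ ⟨$⟩ˡ r)
                  (trans (cong v (Perm.inverseʳ ρ)) vr≡ij)

-- Finite sums and degrees

module _ {c ℓ} (M : CommutativeMonoid c ℓ) where
  open CommutativeMonoid M using (Carrier; _≈_; ε; ∙-congˡ; identityʳ)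
    renaming (trans to ≈-trans)
  open CommutativeMonoidSum M using (sum-remove; sum-cong-≋; sum-replicate-zero)
    renaming (sum to ∑)

  ∑-zero : (t : Fin k → Carrier) → (∀ i → t i ≈ ε) → ∑ t ≈ ε
  ∑-zero {k} t t≈ε = ≈-trans (sum-cong-≋ t≈ε) (sum-replicate-zero k)

  ∑-supported-at : (t : Fin (suc k) → Carrier) (i : Fin (suc k)) →
                   (∀ j → j ≢ i → t j ≈ ε) → ∑ t ≈ t i
  ∑-supported-at t i vanish = ≈-trans (sum-remove t) (≈-trans
    (∙-congˡ (∑-zero _ λ j → vanish (punchIn i j) (Fin.punchInᵢ≢i i j))) (identityʳ (t i)))

private
  ℕ+ : CommutativeMonoid _ _
  ℕ+ = ℕ.+-0-commutativeMonoid
  module ℕΣ = CommutativeMonoidSum ℕ+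

finSum≡∑ : (f : Fin n → ℕ) → finSum f ≡ ℕΣ.sum f
finSum≡∑ {n} f = trans (cong sum (map-tabulate id f)) (sum-tabulate f)
  where
  sum-tabulate : ∀ {n} (f : Fin n → ℕ) → sum (tabulate f) ≡ ℕΣ.sum f
  sum-tabulate {zero}  f = refl
  sum-tabulate {suc n} f = cong (f Fin.zero ℕ.+_) (sum-tabulate (f ∘ Fin.suc))

deg≡∑∑ : (m : Monomial n) → deg m ≡ ℕΣ.sum λ i → ℕΣ.sum λ j → m i j
deg≡∑∑ m = trans (finSum≡∑ λ i → finSum (m i))
                 (ℕΣ.sum-cong-≗ {x = λ i → finSum (m i)} λ i → finSum≡∑ (m i))

finSum-cong : {f g : Fin n → ℕ} → (∀ i → f i ≡ g i) → finSum f ≡ finSum g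
finSum-cong f≗g = cong sum (map-cong f≗g (allFin _))

deg-cong : {m m′ : Monomial n} → m ≗ᴹ m′ → deg m ≡ deg m′
deg-cong {m = m} {m′} m≗m′ =
  finSum-cong {f = λ i → finSum (m i)} {g = λ i → finSum (m′ i)} λ i → finSum-cong (m≗m′ i)

deg-·M : (m m′ : Monomial n) → deg (m ·M m′) ≡ deg m ℕ.+ deg m′
deg-·M m m′ = begin
  deg (m ·M m′)
    ≡⟨ deg≡∑∑ (m ·M m′) ⟩
  ℕΣ.sum (λ i → ℕΣ.sum λ j → m i j ℕ.+ m′ i j)
    ≡⟨ ℕΣ.sum-cong-≗ (λ i → ℕΣ.∑-distrib-+ (m i) (m′ i)) ⟩
  ℕΣ.sum (λ i → ℕΣ.sum (m i) ℕ.+ ℕΣ.sum (m′ i))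
    ≡⟨ ℕΣ.∑-distrib-+ (λ i → ℕΣ.sum (m i)) (λ i → ℕΣ.sum (m′ i)) ⟩
  ℕΣ.sum (λ i → ℕΣ.sum (m i)) ℕ.+ ℕΣ.sum (λ i → ℕΣ.sum (m′ i))
    ≡⟨ sym (cong₂ ℕ._+_ (deg≡∑∑ m) (deg≡∑∑ m′)) ⟩
  deg m ℕ.+ deg m′ ∎
  where open ≡-Reasoning

deg-var : (x : Var n) → deg (var x) ≡ 1
deg-var {suc n} x@(i₀ , j₀) = begin
  deg (var x)                                   ≡⟨ deg≡∑∑ (var x) ⟩
  ℕΣ.sum (λ i → ℕΣ.sum λ j → var x at (i , j))  ≡⟨ ∑-supported-at ℕ+ _ i₀ off-row ⟩
  ℕΣ.sum (λ j → var x at (i₀ , j))              ≡⟨ ∑-supported-at ℕ+ _ j₀ off-column ⟩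
  var x at x                                    ≡⟨ var-self x ⟩
  1                                             ∎
  where
  open ≡-Reasoning
  off-row : ∀ i → i ≢ i₀ → ℕΣ.sum (λ j → var x at (i , j)) ≡ 0
  off-row i i≢i₀ = ∑-zero ℕ+ (λ j → var x at (i , j)) λ j →
    var-other λ x≡ij → i≢i₀ (sym (cong proj₁ x≡ij))
  off-column : ∀ j → j ≢ j₀ → var x at (i₀ , j) ≡ 0
  off-column j j≢j₀ = var-other λ x≡i₀j → j≢j₀ (sym (cong proj₂ x≡i₀j))

deg-prodVars : (v : Fin k → Var n) → deg (prodVars v) ≡ k
deg-prodVars {zero} {n} v = trans (deg≡∑∑ (oneM {n}))
  (∑-zero ℕ+ (λ i → ℕΣ.sum λ j → oneM {n} i j) λ i → ∑-zero ℕ+ (λ j → oneM {n} i j) λ j → refl)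
deg-prodVars {suc k} v = trans (deg-·M (var (v Fin.zero)) (prodVars (v ∘ Fin.suc)))
  (cong₂ ℕ._+_ (deg-var (v Fin.zero)) (deg-prodVars (v ∘ Fin.suc)))

-- The degree reverse lexicographic order

module _ {a} {A : Set a} (μ : A → ℕ) {Q : A → Set}
         (below? : ∀ N → Dec (∃ λ x → μ x < N × Q x)) where

  minimal-witness : ∀ {x} → Q x → ∃ λ y → Q y × (∀ z → μ z < μ y → ¬ Q z)
  minimal-witness {x} = descend x (<-wellFounded (μ x))
    where
    descend : ∀ x → Acc _<_ (μ x) → Q x → ∃ λ y → Q y × (∀ z → μ z < μ y → ¬ Q z)
    descend x (acc smaller) Qx with below? (μ x)
    ... | no  none             = x , Qx , λ z z<x Qz → none (z , z<x , Qz)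
    ... | yes (z , z<x , Qz)   = descend z (smaller z<x) Qz

⪯-byFirstDifference : {m m′ : Monomial n} → deg m ≡ deg m′ →
  (∀ p → m at p < m′ at p → (∀ q → φᵛ q < φᵛ p → m at q ≡ m′ at q) → ⊥) → m ⪯ m′
⪯-byFirstDifference {m = m} {m′} deg≡ not-smaller
  with anyVar? (λ p → ¬? (m at p ℕ.≟ m′ at p))
... | no  none = inj₂ λ i j → decidable-stable (m i j ℕ.≟ m′ i j) λ m≢m′ → none ((i , j) , m≢m′)
... | yes (_ , differ) with minimal-witness φᵛ below? differ
  where
  below? : ∀ N → Dec (∃ λ q → φᵛ q < N × m at q ≢ m′ at q)
  below? N = anyVar? λ q → (φᵛ q ℕ.<? N) ×-dec ¬? (m at q ℕ.≟ m′ at q)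
...   | p , m≢m′ , first = compare (ℕ.<-cmp (m at p) (m′ at p))
  where
  agree : ∀ q → φᵛ q < φᵛ p → m at q ≡ m′ at q
  agree q q<p = decidable-stable (m at q ℕ.≟ m′ at q) (first q q<p)
  compare : Tri (m at p < m′ at p) (m at p ≡ m′ at p) (m′ at p < m at p) → m ⪯ m′
  compare (tri< m<m′ _ _) = contradiction agree (not-smaller p m<m′)
  compare (tri≈ _ m≡m′ _) = contradiction m≡m′ m≢m′
  compare (tri> _ _ m>m′) = inj₁ (inj₂ (deg≡ , p , m>m′ , λ k l → agree (k , l)))

-- Transversals of a matrix of variables

Matrix : ℕ → ℕ → Set
Matrix n k = Fin k → Fin k → Var n

DistinctEntries : Matrix n k → Set
DistinctEntries E = ∀ {r c r′ c′} → E r c ≡ E r′ c′ → r ≡ r′ × c ≡ c′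

IsTransversal : Matrix n k → Monomial n → Set
IsTransversal {k = k} E m = ∃ λ (π : Permutation′ k) → m ≗ᴹ prodVars (λ r → E r (π ⟨$⟩ʳ r))

minor : Matrix n (suc k) → Fin (suc k) → Matrix n k
minor E j r c = E (Fin.suc r) (punchIn j c)

reindex : Matrix n k → Permutation′ k → Permutation′ k → Matrix n k
reindex E ρ γ i j = E (ρ ⟨$⟩ʳ i) (γ ⟨$⟩ʳ j)

diagonal : Matrix n k → Monomial n
diagonal E = prodVars (λ i → E i i)

minor-distinct : {E : Matrix n (suc k)} → DistinctEntries E → ∀ j → DistinctEntries (minor E j)
minor-distinct distinct j Eᵣ꜀≡Eᵣ′꜀′ =
  let r≡r′ , c≡c′ = distinct Eᵣ꜀≡Eᵣ′꜀′
  in suc-injective r≡r′ , Fin.punchIn-injective j _ _ c≡c′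

reindex-distinct : {E : Matrix n k} → DistinctEntries E → ∀ ρ γ →
                   DistinctEntries (reindex E ρ γ)
reindex-distinct distinct ρ γ Eᵣ꜀≡Eᵣ′꜀′ =
  let r≡r′ , c≡c′ = distinct Eᵣ꜀≡Eᵣ′꜀′ in ⟨$⟩ʳ-injective ρ r≡r′ , ⟨$⟩ʳ-injective γ c≡c′

transversal-injective : {E : Matrix n k} → DistinctEntries E → (π : Permutation′ k) →
                        Injective _≡_ _≡_ (λ r → E r (π ⟨$⟩ʳ r))
transversal-injective distinct π = proj₁ ∘ distinct

transversal-cons : (E : Matrix n (suc k)) {m : Monomial n} (j : Fin (suc k)) →
  E Fin.zero j ∣M m → IsTransversal (minor E j) (m ÷ E Fin.zero j) → IsTransversal E m
transversal-cons E {m} j x∣m (π , m÷x≗) =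
  Perm.insert Fin.zero j π , λ i i′ →
    trans (sym (var·÷ {x = E Fin.zero j} {m} x∣m i i′))
          (cong (var (E Fin.zero j) at (i , i′) ℕ.+_) (m÷x≗ i i′))

transversal-uncons : (E : Matrix n (suc k)) (π : Permutation′ (suc k)) {m : Monomial n} →
  m ≗ᴹ prodVars (λ r → E r (π ⟨$⟩ʳ r)) →
  let j = π ⟨$⟩ʳ Fin.zero in E Fin.zero j ∣M m × IsTransversal (minor E j) (m ÷ E Fin.zero j)
transversal-uncons {n} {k} E π {m} m≗ =
  subst (1 ≤_) (sym (m≗ _ _)) (prodVars-∈⇒pos w Fin.zero refl) ,
  Perm.remove Fin.zero π , λ i i′ → begin
    (m ÷ x) i i′
      ≡⟨ cong (_∸ var x at (i , i′)) (m≗ i i′) ⟩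
    (var x ·M prodVars (w ∘ Fin.suc)) i i′ ∸ var x at (i , i′)
      ≡⟨ ÷-var· x (prodVars (w ∘ Fin.suc)) i i′ ⟩
    prodVars (w ∘ Fin.suc) i i′
      ≡⟨ prodVars-cong (λ r → cong (E (Fin.suc r)) (Perm.punchIn-permute π Fin.zero r)) i i′ ⟩
    prodVars (λ r → minor E (π ⟨$⟩ʳ Fin.zero) r (Perm.remove Fin.zero π ⟨$⟩ʳ r)) i i′ ∎
  where
  open ≡-Reasoning
  w : Fin (suc k) → Var n
  w r = E r (π ⟨$⟩ʳ r)
  x : Var n
  x = w Fin.zero

transversal-first-row-unique : {E : Matrix n (suc k)} {m : Monomial n} → DistinctEntries E →
  ∀ {j j′} → j′ ≢ j → E Fin.zero j ∣M m → IsTransversal (minor E j′) (m ÷ E Fin.zero j′) → ⊥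
transversal-first-row-unique {E = E} {m} distinct {j} {j′} j′≢j x∣m (π , m÷x′≗) =
  Fin.0≢1+n (sym (proj₁ (distinct (proj₂ minor-entry≡x))))
  where
  x : Var _
  x = E Fin.zero j
  x′≢x : E Fin.zero j′ ≢ x
  x′≢x = j′≢j ∘ proj₂ ∘ distinct
  minor-entry≡x : ∃ λ r → minor E j′ r (π ⟨$⟩ʳ r) ≡ x
  minor-entry≡x = prodVars-pos⇒∈ _ (subst (1 ≤_)
    (trans (sym (cong (m at x ∸_) (var-other x′≢x))) (m÷x′≗ (proj₁ x) (proj₂ x))) x∣m)

transversal-reindex : {E : Matrix n k} {m : Monomial n} → DistinctEntries E → ∀ ρ γ →
  IsTransversal E m → IsTransversal (reindex E ρ γ) m
transversal-reindex {E = E} distinct ρ γ (π , m≗) =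
  ρ Perm.∘ₚ π Perm.∘ₚ Perm.flip γ , λ i j → trans (m≗ i j) (sym (trans
    (prodVars-cong (λ r → cong (E (ρ ⟨$⟩ʳ r)) (Perm.inverseʳ γ)) i j)
    (prodVars-reindex (transversal-injective distinct π) ρ i j)))

diagonal-transversal : {E : Matrix n k} → DistinctEntries E → ∀ ρ γ →
  IsTransversal E (diagonal (reindex E ρ γ))
diagonal-transversal {E = E} distinct ρ γ = Perm.flip ρ Perm.∘ₚ γ , λ i j →
  trans (prodVars-cong (λ r → cong (λ r′ → E (ρ ⟨$⟩ʳ r) (γ ⟨$⟩ʳ r′)) (sym (Perm.inverseˡ ρ))) i j)
        (prodVars-reindex (transversal-injective distinct (Perm.flip ρ Perm.∘ₚ γ)) ρ i j)

-- Coefficients of the determinant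

module Coefficients {c ℓ} (K : Field c ℓ) where
  open Field K renaming (refl to ≈-refl; sym to ≈-sym; trans to ≈-trans)
  open Poly K
  open import Relation.Binary.Reasoning.Setoid setoid
  open import Algebra.Properties.Ring ring using (-‿involutive; -‿distribˡ-*; -‿distribʳ-*)
  open import Algebra.Properties.CommutativeSemigroup *-commutativeSemigroup using (interchange)
  open CommutativeMonoidSum +-commutativeMonoid using () renaming (sum to ∑)
  open import Data.List.Base using ([]; _∷_; _++_; concatMap)

  -- Coefficients ±1 are recorded as x * x ≈ 1#, which is closed under products and excludes 0.
  IsSign : Carrier → Set ℓ
  IsSign x = x * x ≈ 1#

  sign-cong : ∀ {x y} → x ≈ y → IsSign x → IsSign y
  sign-cong x≈y x²≈1 = ≈-trans (*-cong (≈-sym x≈y) (≈-sym x≈y)) x²≈1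

  sign-* : ∀ {x y} → IsSign x → IsSign y → IsSign (x * y)
  sign-* {x} {y} x²≈1 y²≈1 = begin
    (x * y) * (x * y) ≈⟨ interchange x y x y ⟩
    (x * x) * (y * y) ≈⟨ *-cong x²≈1 y²≈1 ⟩
    1# * 1#           ≈⟨ *-identityˡ 1# ⟩
    1#                ∎

  sgn-sign : ∀ {k} (j : Fin k) → IsSign (sgn j)
  sgn-sign Fin.zero    = *-identityˡ 1#
  sgn-sign (Fin.suc j) = begin
    - sgn j * - sgn j   ≈⟨ -‿distribˡ-* (sgn j) (- sgn j) ⟨
    - (sgn j * - sgn j) ≈⟨ -‿cong (-‿distribʳ-* (sgn j) (sgn j)) ⟨
    - - (sgn j * sgn j) ≈⟨ -‿involutive (sgn j * sgn j) ⟩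
    sgn j * sgn j       ≈⟨ sgn-sign j ⟩
    1#                  ∎

  sign≉0 : ∀ {x} → IsSign x → ¬ x ≈ 0#
  sign≉0 {x} x²≈1 x≈0 = 0≉1 (begin
    0#      ≈⟨ zeroˡ 0# ⟨
    0# * 0# ≈⟨ *-cong x≈0 x≈0 ⟨
    x * x   ≈⟨ x²≈1 ⟩
    1#      ∎)

  coeff-∷-≗ : ∀ {n a} {m′ m : Monomial n} f → m′ ≗ᴹ m →
              coeff ((a , m′) ∷ f) m ≈ a + coeff f m
  coeff-∷-≗ {m′ = m′} {m} f m′≗m with m′ ≟M m
  ... | yes _     = ≈-refl
  ... | no  m′≉m = contradiction m′≗m m′≉m

  coeff-∷-≉ : ∀ {n a} {m′ m : Monomial n} f → ¬ m′ ≗ᴹ m →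
              coeff ((a , m′) ∷ f) m ≈ coeff f m
  coeff-∷-≉ {m′ = m′} {m} f m′≉m with m′ ≟M m
  ... | yes m′≗m = contradiction m′≗m m′≉m
  ... | no  _    = ≈-refl

  coeff-++ : ∀ {n} (f g : Poly n) m → coeff (f ++ g) m ≈ coeff f m + coeff g m
  coeff-++ []             g m = ≈-sym (+-identityˡ _)
  coeff-++ ((a , m′) ∷ f) g m with m′ ≟M m
  ... | yes _ = ≈-trans (+-congˡ (coeff-++ f g m)) (≈-sym (+-assoc _ _ _))
  ... | no  _ = coeff-++ f g m

  coeff-concatMap : ∀ {n k} {A : Set} (t : A → Poly n) (g : Fin k → A) m →
                    coeff (concatMap t (tabulate g)) m ≈ ∑ (λ j → coeff (t (g j)) m)
  coeff-concatMap {k = zero}  t g m = ≈-refl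
  coeff-concatMap {k = suc k} t g m =
    ≈-trans (coeff-++ (t (g Fin.zero)) _ m) (+-congˡ (coeff-concatMap t (g ∘ Fin.suc) m))

  scaleByVar : ∀ {n} → Carrier → Var n → Poly n → Poly n
  scaleByVar a x = map λ t → (a * proj₁ t , var x ·M proj₂ t)

  coeff-scaleByVar-∣ : ∀ {n a} {x : Var n} {m} f → x ∣M m →
                       coeff (scaleByVar a x f) m ≈ a * coeff f (m ÷ x)
  coeff-scaleByVar-∣ {a = a} []             x∣m = ≈-sym (zeroʳ a)
  coeff-scaleByVar-∣ {a = a} {x} {m} ((b , m′) ∷ f) x∣m with m′ ≟M (m ÷ x)
  ... | yes m′≗m÷x = begin
    coeff ((a * b , var x ·M m′) ∷ scaleByVar a x f) m
      ≈⟨ coeff-∷-≗ (scaleByVar a x f) x·m′≗m ⟩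
    a * b + coeff (scaleByVar a x f) m
      ≈⟨ +-congˡ (coeff-scaleByVar-∣ f x∣m) ⟩
    a * b + a * coeff f (m ÷ x)
      ≈⟨ distribˡ a b _ ⟨
    a * (b + coeff f (m ÷ x)) ∎
    where
    x·m′≗m : var x ·M m′ ≗ᴹ m
    x·m′≗m i j = trans (cong (var x at (i , j) ℕ.+_) (m′≗m÷x i j)) (var·÷ {x = x} {m} x∣m i j)
  ... | no  m′≉m÷x = ≈-trans (coeff-∷-≉ (scaleByVar a x f) x·m′≉m) (coeff-scaleByVar-∣ f x∣m)
    where
    x·m′≉m : ¬ var x ·M m′ ≗ᴹ m
    x·m′≉m x·m′≗m = m′≉m÷x λ i j →
      trans (sym (÷-var· x m′ i j)) (cong (_∸ var x at (i , j)) (x·m′≗m i j))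

  coeff-scaleByVar-∤ : ∀ {n a} {x : Var n} {m} f → ¬ x ∣M m →
                       coeff (scaleByVar a x f) m ≈ 0#
  coeff-scaleByVar-∤ []                 x∤m = ≈-refl
  coeff-scaleByVar-∤ {x = x} ((b , m′) ∷ f) x∤m =
    ≈-trans (coeff-∷-≉ _ x·m′≉m) (coeff-scaleByVar-∤ f x∤m)
    where
    x·m′≉m : ¬ var x ·M m′ ≗ᴹ _
    x·m′≉m x·m′≗m = x∤m (subst (1 ≤_) (x·m′≗m (proj₁ x) (proj₂ x))
      (ℕ.≤-trans (ℕ.≤-reflexive (sym (var-self x))) (ℕ.m≤m+n _ _)))

  CoefficientShape : ∀ {n k} → Matrix n k → Monomial n → Set ℓ
  CoefficientShape {k = k} E m = (¬ IsTransversal E m × coeff (det k E) m ≈ 0#)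
                               ⊎ (IsTransversal E m × IsSign (coeff (det k E) m))

  det-coefficient : ∀ {n k} {E : Matrix n k} → DistinctEntries E → ∀ m → CoefficientShape E m
  det-coefficient {k = zero} {E} _ m = shape (oneM ≟M m)
    where
    shape : Dec (oneM ≗ᴹ m) → CoefficientShape E m
    shape (yes 1≗m) = inj₂ ((Perm.id , λ i j → sym (1≗m i j)) , sign-cong
      (≈-sym (≈-trans (coeff-∷-≗ [] 1≗m) (+-identityʳ 1#))) (*-identityˡ 1#))
    shape (no 1≉m)  = inj₁ ((λ (_ , m≗1) → 1≉m λ i j → sym (m≗1 i j)) , coeff-∷-≉ [] 1≉m)
  det-coefficient {n} {suc k} {E} distinct m = shape (any? expands?)
    where
    x : Fin (suc k) → Var n
    x j = E Fin.zero j
    minor-shape : ∀ j → CoefficientShape (minor E j) (m ÷ x j)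
    minor-shape j = det-coefficient (minor-distinct distinct j) (m ÷ x j)
    Expands : Fin (suc k) → Set
    Expands j = x j ∣M m × IsTransversal (minor E j) (m ÷ x j)
    expands? : ∀ j → Dec (Expands j)
    expands? j with minor-shape j
    ... | inj₁ (¬t , _) = no (¬t ∘ proj₂)
    ... | inj₂ (t , _)  = map′ (_, t) proj₁ (1 ℕ.≤? m at x j)
    term : Fin (suc k) → Carrier
    term j = coeff (scaleByVar (sgn j) (x j) (det k (minor E j))) m
    expand : coeff (det (suc k) E) m ≈ ∑ term
    expand = coeff-concatMap (λ j → scaleByVar (sgn j) (x j) (det k (minor E j))) id m
    term-vanishes : ∀ j → ¬ Expands j → term j ≈ 0#
    term-vanishes j ¬e with 1 ℕ.≤? m at x j | minor-shape j
    ... | no  x∤m | _              = coeff-scaleByVar-∤ (det k (minor E j)) x∤m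
    ... | yes x∣m | inj₁ (_ , c≈0) = ≈-trans (coeff-scaleByVar-∣ (det k (minor E j)) x∣m)
                                              (≈-trans (*-congˡ c≈0) (zeroʳ _))
    ... | yes x∣m | inj₂ (t , _)   = contradiction (x∣m , t) ¬e
    shape : Dec (∃ Expands) → CoefficientShape E m
    shape (no none) = inj₁ ((λ (π , m≗) → none (_ , transversal-uncons E π m≗)) ,
      ≈-trans expand (∑-zero +-commutativeMonoid term λ j → term-vanishes j (none ∘ (j ,_))))
    shape (yes (j , x∣m , t)) = inj₂ (transversal-cons E j x∣m t , sign-cong (≈-sym value) sign)
      where
      value : coeff (det (suc k) E) m ≈ sgn j * coeff (det k (minor E j)) (m ÷ x j)
      value = ≈-trans expand (≈-trans
        (∑-supported-at +-commutativeMonoid term j λ j′ j′≢j →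
          term-vanishes j′ λ (_ , t′) → transversal-first-row-unique distinct j′≢j x∣m t′)
        (coeff-scaleByVar-∣ (det k (minor E j)) x∣m))
      sign : IsSign (sgn j * coeff (det k (minor E j)) (m ÷ x j))
      sign with minor-shape j
      ... | inj₁ (¬t , _)  = contradiction t ¬t
      ... | inj₂ (_ , ±1) = sign-* (sgn-sign j) ±1

  leading-transversal : ∀ {n k} {E : Matrix n k} {m} → DistinctEntries E → IsTransversal E m →
    (∀ {m′} → IsTransversal E m′ → m′ ⪯ m) → IsLeadingMonomial (det k E) m
  leading-transversal {E = E} {m} distinct t dominates =
    nonzero , λ m′ c≉0 → dominates (occurs m′ c≉0)
    where
    nonzero : ¬ coeff (det _ E) m ≈ 0#
    nonzero with det-coefficient distinct m
    ... | inj₁ (¬t , _)  = contradiction t ¬t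
    ... | inj₂ (_ , ±1) = sign≉0 ±1
    occurs : ∀ m′ → ¬ coeff (det _ E) m′ ≈ 0# → IsTransversal E m′
    occurs m′ c≉0 with det-coefficient distinct m′
    ... | inj₁ (_ , c≈0) = contradiction c≈0 c≉0
    ... | inj₂ (t′ , _)  = t′

open import Data.Nat.Base using (_+_; _*_)

-- Dominance of the diagonal

transversal-⪯-diagonal : {E : Matrix n k} → DistinctEntries E →
  (∀ {i r c} → i Fin.≤ r → c Fin.≤ i → (r , c) ≢ (i , i) → φᵛ (E r c) < φᵛ (E i i)) →
  ∀ {m} → IsTransversal E m → m ⪯ diagonal E
transversal-⪯-diagonal {E = E} distinct southWest {m} (π , m≗) =
  ⪯-byFirstDifference (trans (deg-cong m≗) (trans (deg-prodVars (λ r → E r (σ r)))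
                                                   (sym (deg-prodVars (λ i → E i i))))) not-smaller
  where
  σ : Fin _ → Fin _
  σ = π ⟨$⟩ʳ_
  diag-injective : Injective _≡_ _≡_ (λ i → E i i)
  diag-injective = proj₁ ∘ distinct
  m-has : ∀ r → 1 ≤ m at E r (σ r)
  m-has r = subst (1 ≤_) (sym (m≗ _ _)) (prodVars-∈⇒pos _ r refl)

  not-smaller : ∀ p → m at p < diagonal E at p →
                (∀ q → φᵛ q < φᵛ p → m at q ≡ diagonal E at q) → ⊥
  not-smaller p m<d agree with prodVars-pos⇒∈ (λ i → E i i) (ℕ.≤-trans (s≤s z≤n) m<d)
  ... | i₀ , refl =
    let y , i₀≤y , σy≡i₀ =
          invariant-preimage (⟨$⟩ʳ-injective π) (i₀ Fin.≤_) ℕ.≤-refl (ℕ.<⇒≤ ∘ moves-up)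
    in ℕ.<-irrefl (cong toℕ (sym σy≡i₀)) (moves-up i₀≤y)
    where
    σi₀≢i₀ : σ i₀ ≢ i₀
    σi₀≢i₀ σi₀≡i₀ = ℕ.<-irrefl refl (ℕ.≤-trans (s≤s m-has-p) (ℕ.≤-trans m<d d≤1))
      where
      m-has-p : 1 ≤ m at E i₀ i₀
      m-has-p = subst (λ c → 1 ≤ m at E i₀ c) σi₀≡i₀ (m-has i₀)
      d≤1 : diagonal E at E i₀ i₀ ≤ 1
      d≤1 = prodVars-≤1 diag-injective (E i₀ i₀)

    -- An entry of σ off the diagonal is not φ-earlier than x_{i₀i₀}, so it is not south-west of it.
    moves-up : ∀ {r} → i₀ Fin.≤ r → i₀ Fin.< σ r
    moves-up {r} i₀≤r with σ r Fin.≟ r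
    ... | yes σr≡r = subst (i₀ Fin.<_) (sym σr≡r) (ℕ.≤∧≢⇒< i₀≤r λ i₀≡r →
                       σi₀≢i₀ (subst (λ s → σ s ≡ s) (sym (toℕ-injective i₀≡r)) σr≡r))
    ... | no  σr≢r = ℕ.≰⇒> λ σr≤i₀ → not-earlier (southWest i₀≤r σr≤i₀ λ rσr≡i₀i₀ →
                       σr≢r (trans (cong proj₂ rσr≡i₀i₀) (sym (cong proj₁ rσr≡i₀i₀))))
      where
      d-lacks : diagonal E at E r (σ r) ≡ 0
      d-lacks = prodVars-∉⇒0 (λ i → E i i) λ i Eᵢᵢ≡Eᵣσᵣ →
        let i≡r , i≡σr = distinct Eᵢᵢ≡Eᵣσᵣ in σr≢r (trans (sym i≡σr) i≡r)
      not-earlier : ¬ φᵛ (E r (σ r)) < φᵛ (E i₀ i₀)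
      not-earlier earlier = ℕ.<⇒≢ (m-has r) (sym (trans (agree _ earlier) d-lacks))

-- The variable order

0<m≤n⇒[n∸m]%n≡n∸m : ∀ {m n} .{{_ : NonZero n}} → 0 < m → m ≤ n → (n ∸ m) % n ≡ n ∸ m
0<m≤n⇒[n∸m]%n≡n∸m 0<m m≤n = m<n⇒m%n≡m (ℕ.∸-monoʳ-< 0<m m≤n)

-[1+]%ℕ : ∀ x {d} .{{_ : NonZero d}} {r} → r < d → suc x % d ≡ (d ∸ r) % d → -[1+ x ] %ℕ d ≡ r
-[1+]%ℕ x {d} {zero} _ 1+x%d≡d%d with suc x % d
... | zero  = refl
... | suc _ = contradiction (trans 1+x%d≡d%d (n%n≡0 d)) λ ()
-[1+]%ℕ x {d} {suc r} r<d 1+x%d≡[d∸r]%d with suc x % d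
... | zero  = contradiction (trans 1+x%d≡[d∸r]%d [d∸r]%d≡d∸r) (ℕ.<⇒≢ (ℕ.m<n⇒0<n∸m r<d))
  where [d∸r]%d≡d∸r = 0<m≤n⇒[n∸m]%n≡n∸m (s≤s z≤n) (ℕ.<⇒≤ r<d)
... | suc s = begin
  d ∸ suc s       ≡⟨ cong (d ∸_) (trans 1+x%d≡[d∸r]%d [d∸r]%d≡d∸r) ⟩
  d ∸ (d ∸ suc r) ≡⟨ ℕ.m∸[m∸n]≡n (ℕ.<⇒≤ r<d) ⟩
  suc r           ∎
  where
  open ≡-Reasoning
  [d∸r]%d≡d∸r : (d ∸ suc r) % d ≡ d ∸ suc r
  [d∸r]%d≡d∸r = 0<m≤n⇒[n∸m]%n≡n∸m (s≤s z≤n) (ℕ.<⇒≤ r<d)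

%ℕ-unique : ∀ {d} .{{_ : NonZero d}} {r} (z : ℤ) → r < d → (+ r ℤ.+ z ℤ.* + d) %ℕ d ≡ r
%ℕ-unique {d} {r} (+ q) r<d = begin
  (+ r ℤ.+ + q ℤ.* + d) %ℕ d ≡⟨ cong (λ t → (+ r ℤ.+ t) %ℕ d) (sym (ℤ.pos-* q d)) ⟩
  (r + q * d) % d            ≡⟨ [m+kn]%n≡m%n r q d ⟩
  r % d                      ≡⟨ m<n⇒m%n≡m r<d ⟩
  r                          ∎
  where open ≡-Reasoning
%ℕ-unique {d@(suc d′)} {r} -[1+ q ] r<d = begin
  (+ r ℤ.+ -[1+ M ]) %ℕ d ≡⟨ cong (_%ℕ d) (ℤ.⊖-< r<1+M) ⟩
  ℤ.- + (suc M ∸ r) %ℕ d  ≡⟨ cong (λ t → ℤ.- + t %ℕ d) (ℕ.+-∸-assoc 1 r≤M) ⟩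
  -[1+ M ∸ r ] %ℕ d       ≡⟨ -[1+]%ℕ (M ∸ r) r<d 1+M∸r%d ⟩
  r                       ∎
  where
  open ≡-Reasoning
  M : ℕ
  M = d′ + q * d
  r≤M : r ≤ M
  r≤M = ℕ.≤-trans (ℕ.≤-pred r<d) (ℕ.m≤m+n d′ (q * d))
  r<1+M : r < suc M
  r<1+M = s≤s r≤M
  1+M∸r%d : suc (M ∸ r) % d ≡ (d ∸ r) % d
  1+M∸r%d = begin
    suc (M ∸ r) % d     ≡⟨ cong (_% d) (sym (ℕ.+-∸-assoc 1 r≤M)) ⟩
    (d + q * d ∸ r) % d ≡⟨ cong (_% d) (ℕ.+-∸-comm (q * d) (ℕ.<⇒≤ r<d)) ⟩
    (d ∸ r + q * d) % d ≡⟨ [m+kn]%n≡m%n (d ∸ r) q d ⟩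
    (d ∸ r) % d         ∎

digits-< : ∀ {d d′ e e′ n} → e < n → d < d′ → d * n + e < d′ * n + e′
digits-< {d} {d′} {e} {e′} {n} e<n d<d′ = begin-strict
  d * n + e   <⟨ ℕ.+-monoʳ-< (d * n) e<n ⟩
  d * n + n   ≡⟨ ℕ.+-comm (d * n) n ⟩
  suc d * n   ≤⟨ ℕ.*-monoˡ-≤ n d<d′ ⟩
  d′ * n      ≤⟨ ℕ.m≤m+n (d′ * n) e′ ⟩
  d′ * n + e′ ∎
  where open ℕ.≤-Reasoning

-- φ(i,j) - 1 is n (j - i) + (n - 1 - j) reduced modulo n², that is n d + (n - 1 - j) where
-- 0 ≤ d < n represents j - i modulo n.
φ-offset : (i j : Fin (suc k)) {d x y : ℕ} → d < suc k →
           d + toℕ i + x * suc k ≡ toℕ j + y * suc k → φ (suc k) i j ≡ suc (d * suc k + (k ∸ toℕ j))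
φ-offset {k} i j {d} {x} {y} d<1+k offset = cong suc (begin
  v %ℕ (suc k * suc k)                         ≡⟨ cong (_%ℕ (suc k * suc k)) v≡w+z[1+k]² ⟩
  (+ w ℤ.+ z ℤ.* + (suc k * suc k)) %ℕ (suc k * suc k) ≡⟨ %ℕ-unique z w<[1+k]² ⟩
  w                                            ∎)
  where
  open ≡-Reasoning
  I J : ℕ
  I = toℕ i
  J = toℕ j
  v : ℤ
  v = ((+ 2 ℤ.- + suc I) ℤ.* + suc k) ℤ.+ ((+ suc J ℤ.- + 1) ℤ.* (+ suc k ℤ.- + 1)) ℤ.- + 1
  w : ℕ
  w = d * suc k + (k ∸ J)
  z : ℤ
  z = + x ℤ.- + y
  w<[1+k]² : w < suc k * suc k
  w<[1+k]² =
    subst (w <_) (ℕ.+-identityʳ (suc k * suc k)) (digits-< (s≤s (ℕ.m∸n≤m k J)) d<1+k)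
  identity : ∀ I J D X Y K → let N = + 1 ℤ.+ K in
    ((+ 2 ℤ.- (+ 1 ℤ.+ I)) ℤ.* N) ℤ.+ (((+ 1 ℤ.+ J) ℤ.- + 1) ℤ.* (N ℤ.- + 1)) ℤ.- + 1
    ≡ (D ℤ.* N ℤ.+ (K ℤ.- J)) ℤ.+ (X ℤ.- Y) ℤ.* (N ℤ.* N)
      ℤ.+ N ℤ.* ((J ℤ.+ Y ℤ.* N) ℤ.- (D ℤ.+ I ℤ.+ X ℤ.* N))
  identity = solve-∀
  offset-vanishes : (+ J ℤ.+ + y ℤ.* + suc k) ℤ.- (+ d ℤ.+ + I ℤ.+ + x ℤ.* + suc k) ≡ ℤ.0ℤ
  offset-vanishes = begin
    (+ J ℤ.+ + y ℤ.* + suc k) ℤ.- (+ d ℤ.+ + I ℤ.+ + x ℤ.* + suc k)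
      ≡⟨ cong₂ (λ a b → (+ J ℤ.+ a) ℤ.- (+ d ℤ.+ + I ℤ.+ b))
               (sym (ℤ.pos-* y (suc k))) (sym (ℤ.pos-* x (suc k))) ⟩
    + (J + y * suc k) ℤ.- + (d + I + x * suc k)
      ≡⟨ cong (λ a → + a ℤ.- + (d + I + x * suc k)) (sym offset) ⟩
    + (d + I + x * suc k) ℤ.- + (d + I + x * suc k)
      ≡⟨ ℤ.+-inverseʳ (+ (d + I + x * suc k)) ⟩
    ℤ.0ℤ ∎
  v≡w+z[1+k]² : v ≡ + w ℤ.+ z ℤ.* + (suc k * suc k)
  v≡w+z[1+k]² = begin
    v ≡⟨ identity (+ I) (+ J) (+ d) (+ x) (+ y) (+ k) ⟩
    main ℤ.+ + suc k ℤ.* ((+ J ℤ.+ + y ℤ.* + suc k) ℤ.- (+ d ℤ.+ + I ℤ.+ + x ℤ.* + suc k))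
      ≡⟨ cong (λ e → main ℤ.+ + suc k ℤ.* e) offset-vanishes ⟩
    main ℤ.+ + suc k ℤ.* ℤ.0ℤ
      ≡⟨ trans (cong (λ e → main ℤ.+ e) (ℤ.*-zeroʳ (+ suc k))) (ℤ.+-identityʳ main) ⟩
    main
      ≡⟨ cong₂ (λ a b → (a ℤ.+ b) ℤ.+ z ℤ.* (+ suc k ℤ.* + suc k))
               (sym (ℤ.pos-* d (suc k))) k-J≡k∸J ⟩
    + w ℤ.+ z ℤ.* (+ suc k ℤ.* + suc k)
      ≡⟨ cong (λ a → + w ℤ.+ z ℤ.* a) (sym (ℤ.pos-* (suc k) (suc k))) ⟩
    + w ℤ.+ z ℤ.* + (suc k * suc k) ∎
    where
    main : ℤ
    main = (+ d ℤ.* + suc k ℤ.+ (+ k ℤ.- + J)) ℤ.+ z ℤ.* (+ suc k ℤ.* + suc k)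
    k-J≡k∸J : + k ℤ.- + J ≡ + (k ∸ J)
    k-J≡k∸J = trans (ℤ.m-n≡m⊖n k J) (ℤ.⊖-≥ (ℕ.≤-pred (toℕ<n j)))

-- Unrolling and rotating

m+o≡[m-mod-n]+o+[m/n]*n : ∀ m o {n} .{{_ : NonZero n}} → m + o ≡ toℕ (m mod n) + o + m / n * n
m+o≡[m-mod-n]+o+[m/n]*n m o {n} = begin
  m + o                      ≡⟨ cong (_+ o) (m≡m%n+[m/n]*n m n) ⟩
  m % n + m / n * n + o      ≡⟨ xy∙z≈xz∙y (m % n) (m / n * n) o ⟩
  m % n + o + m / n * n      ≡⟨ cong (λ r → r + o + m / n * n) (toℕ-fromℕ< _) ⟨
  toℕ (m mod n) + o + m / n * n ∎
  where open ≡-Reasoning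

mod-period : ∀ {s} (t : Fin (suc s)) q → (toℕ t + q * suc s) mod suc s ≡ t
mod-period {s} t q = toℕ-injective (begin
  toℕ ((toℕ t + q * suc s) mod suc s) ≡⟨ toℕ-fromℕ< _ ⟩
  (toℕ t + q * suc s) % suc s         ≡⟨ [m+kn]%n≡m%n (toℕ t) q (suc s) ⟩
  toℕ t % suc s                       ≡⟨ m<n⇒m%n≡m (toℕ<n t) ⟩
  toℕ t                               ∎)
  where open ≡-Reasoning

div-period : ∀ {s} (t : Fin (suc s)) q → (toℕ t + q * suc s) / suc s ≡ q
div-period {s} t q = begin
  (toℕ t + q * suc s) / suc s        ≡⟨ +-distrib-/ (toℕ t) (q * suc s) no-carry ⟩
  toℕ t / suc s + q * suc s / suc s  ≡⟨ cong₂ _+_ (m<n⇒m/n≡0 (toℕ<n t)) (m*n/n≡m q (suc s)) ⟩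
  q                                  ∎
  where
  open ≡-Reasoning
  no-carry : toℕ t % suc s + q * suc s % suc s < suc s
  no-carry = subst (_< suc s) (sym (cong₂ _+_ (m<n⇒m%n≡m (toℕ<n t)) (m*n%n≡0 q (suc s))))
               (subst (_< suc s) (sym (ℕ.+-identityʳ (toℕ t))) (toℕ<n t))

unroll : ∀ {s n} → (Fin (suc s) → Fin n) → ℕ → ℕ
unroll {s} {n} a x = toℕ (a (x mod suc s)) + x / suc s * n

module _ {s n} (a : Fin (suc s) → Fin n) where

  private
    s′ : ℕ
    s′ = suc s

  unroll-period : (t : Fin s′) (q : ℕ) → unroll a (toℕ t + q * s′) ≡ toℕ (a t) + q * n
  unroll-period t q = cong₂ (λ u p → toℕ (a u) + p * n) (mod-period t q) (div-period t q)

  unroll-fin : (t : Fin s′) → unroll a (toℕ t) ≡ toℕ (a t)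
  unroll-fin t = trans (cong (unroll a) (sym (ℕ.+-identityʳ (toℕ t))))
                       (trans (unroll-period t 0) (ℕ.+-identityʳ _))

  unroll-< : ∀ {x} → x < s′ → unroll a x < n
  unroll-< {x} x<s′ =
    subst (_< n) (sym (cong (λ p → toℕ (a (x mod s′)) + p * n) (m<n⇒m/n≡0 x<s′)))
          (subst (_< n) (sym (ℕ.+-identityʳ _)) (toℕ<n (a (x mod s′))))

  module _ (a-increasing : StrictlyIncreasing a) where

    unroll-increasing : ∀ {x y} → x < y → unroll a x < unroll a y
    unroll-increasing {x} {y} x<y with ℕ.m≤n⇒m<n∨m≡n (/-monoˡ-≤ s′ (ℕ.<⇒≤ x<y))
    ... | inj₁ x/s′<y/s′ = begin-strict
      toℕ (a (x mod s′)) + x / s′ * n <⟨ ℕ.+-monoˡ-< (x / s′ * n) (toℕ<n (a (x mod s′))) ⟩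
      suc (x / s′) * n                ≤⟨ ℕ.*-monoˡ-≤ n x/s′<y/s′ ⟩
      y / s′ * n                      ≤⟨ ℕ.m≤n+m (y / s′ * n) (toℕ (a (y mod s′))) ⟩
      unroll a y                      ∎
      where open ℕ.≤-Reasoning
    ... | inj₂ x/s′≡y/s′ = subst (λ p → unroll a x < toℕ (a (y mod s′)) + p * n) x/s′≡y/s′
            (ℕ.+-monoˡ-< (x / s′ * n) (a-increasing (x mod s′) (y mod s′) x%s′<y%s′))
      where
      x%s′<y%s′ : toℕ (x mod s′) < toℕ (y mod s′)
      x%s′<y%s′ = subst₂ _<_ (sym (toℕ-fromℕ< _)) (sym (toℕ-fromℕ< _))
        (ℕ.+-cancelʳ-< (x / s′ * s′) (x % s′) (y % s′) (subst₂ _<_ (m≡m%n+[m/n]*n x s′)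
          (trans (m≡m%n+[m/n]*n y s′) (cong (λ p → y % s′ + p * s′) (sym x/s′≡y/s′))) x<y))

    unroll-monotone : ∀ {x y} → x ≤ y → unroll a x ≤ unroll a y
    unroll-monotone x≤y with ℕ.m≤n⇒m<n∨m≡n x≤y
    ... | inj₁ x<y  = ℕ.<⇒≤ (unroll-increasing x<y)
    ... | inj₂ refl = ℕ.≤-refl

module _ {s n} {a b : Fin (suc s) → Fin n} (a-increasing : StrictlyIncreasing a) where

  private
    s′ : ℕ
    s′ = suc s

  unroll-shift : ∀ {ℓ} → ShiftOK a b ℓ → ∀ x → unroll b x < unroll a (x + ℓ)
  unroll-shift {ℓ} shift x with toℕ (x mod s′) + ℓ ℕ.<? s′
  ... | yes t+ℓ<s′ = begin-strict
    toℕ (b t) + q * n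
      <⟨ ℕ.+-monoˡ-< (q * n) (shift t u (ℕ.m+n≤o⇒m≤o∸n (suc (toℕ t)) t+ℓ<s′) (toℕ-fromℕ< t+ℓ<s′)) ⟩
    toℕ (a u) + q * n             ≡⟨ unroll-period a u q ⟨
    unroll a (toℕ u + q * s′)     ≡⟨ cong (λ p → unroll a (p + q * s′)) (toℕ-fromℕ< t+ℓ<s′) ⟩
    unroll a (toℕ t + ℓ + q * s′) ≡⟨ cong (unroll a) (m+o≡[m-mod-n]+o+[m/n]*n x ℓ) ⟨
    unroll a (x + ℓ)              ∎
    where
    open ℕ.≤-Reasoning
    t : Fin s′
    t = x mod s′
    q : ℕ
    q = x / s′
    u : Fin s′
    u = Fin.fromℕ< t+ℓ<s′
  ... | no  t+ℓ≮s′ = begin-strict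
    toℕ (b t) + q * n            <⟨ ℕ.+-monoˡ-< (q * n) (toℕ<n (b t)) ⟩
    suc q * n                    ≤⟨ ℕ.m≤n+m (suc q * n) (toℕ (a Fin.zero)) ⟩
    toℕ (a Fin.zero) + suc q * n ≡⟨ unroll-period a Fin.zero (suc q) ⟨
    unroll a (suc q * s′)        ≤⟨ unroll-monotone a a-increasing (subst (suc q * s′ ≤_)
                                      (sym (m+o≡[m-mod-n]+o+[m/n]*n x ℓ))
                                      (ℕ.+-monoˡ-≤ (q * s′) (ℕ.≮⇒≥ t+ℓ≮s′))) ⟩
    unroll a (x + ℓ)             ∎
    where
    open ℕ.≤-Reasoning
    t : Fin s′
    t = x mod s′
    q : ℕ
    q = x / s′

  shift-violation : ∀ {ℓ} → ¬ ShiftOK a b ℓ →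
                    ∃₂ λ t u → toℕ u ≡ toℕ t + ℓ × toℕ (a u) ≤ toℕ (b t)
  shift-violation {ℓ} ¬shift =
    let t , ¬∀u  = Fin.¬∀⟶∃¬ s′ _ (λ t → Fin.all? (holds? t)) ¬shift
        u , ¬okᵤ = Fin.¬∀⟶∃¬ s′ _ (holds? t) ¬∀u
    in t , u ,
       decidable-stable (toℕ u ℕ.≟ toℕ t + ℓ) (λ u≢t+ℓ → ¬okᵤ λ _ u≡t+ℓ → contradiction u≡t+ℓ u≢t+ℓ) ,
       ℕ.≮⇒≥ λ bₜ<aᵤ → ¬okᵤ λ _ _ → bₜ<aᵤ
    where
    holds? : ∀ t u → Dec (toℕ t < s′ ∸ ℓ → toℕ u ≡ toℕ t + ℓ → toℕ (b t) < toℕ (a u))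
    holds? t u =
      (toℕ t ℕ.<? s′ ∸ ℓ) →-dec ((toℕ u ℕ.≟ toℕ t + ℓ) →-dec (toℕ (b t) ℕ.<? toℕ (a u)))

  -- For ℓ > 0, T is a place where ShiftOK fails for ℓ - 1, so that a_{T+ℓ-1} ≤ b_T.
  shift-cut : ∀ {ℓ} → IsShift a b ℓ →
              ∃ λ (T : Fin s′) → ∀ x → x < s′ → unroll a (x + (toℕ T + ℓ)) ≤ n + toℕ (b T)
  shift-cut {zero} _ = Fin.zero , λ x x<s′ → ℕ.≤-trans
    (ℕ.<⇒≤ (unroll-< a (subst (_< s′) (sym (ℕ.+-identityʳ x)) x<s′))) (ℕ.m≤m+n n _)
  shift-cut {suc ℓ} (_ , _ , minimal) =
    let t , u , u≡t+ℓ , aᵤ≤bₜ = shift-violation (minimal ℓ ℕ.≤-refl)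
    in t , λ x x<s′ → begin
      unroll a (x + (toℕ t + suc ℓ)) ≤⟨ unroll-monotone a a-increasing (bound t u u≡t+ℓ x<s′) ⟩
      unroll a (toℕ u + 1 * s′)      ≡⟨ unroll-period a u 1 ⟩
      toℕ (a u) + 1 * n              ≤⟨ ℕ.+-monoˡ-≤ (1 * n) aᵤ≤bₜ ⟩
      toℕ (b t) + 1 * n              ≡⟨ trans (ℕ.+-comm (toℕ (b t)) (1 * n))
                                               (cong (_+ toℕ (b t)) (ℕ.*-identityˡ n)) ⟩
      n + toℕ (b t)                  ∎
    where
    open ℕ.≤-Reasoning
    bound : ∀ {ℓ} t u → toℕ u ≡ toℕ t + ℓ → ∀ {x} → x < s′ → x + (toℕ t + suc ℓ) ≤ toℕ u + 1 * s′
    bound {ℓ} t u u≡t+ℓ {x} x<s′ = begin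
      x + (toℕ t + suc ℓ) ≡⟨ cong (λ e → x + e) (ℕ.+-suc (toℕ t) ℓ) ⟩
      x + suc (toℕ t + ℓ) ≡⟨ ℕ.+-suc x (toℕ t + ℓ) ⟩
      suc x + (toℕ t + ℓ) ≤⟨ ℕ.+-monoˡ-≤ (toℕ t + ℓ) x<s′ ⟩
      s′ + (toℕ t + ℓ)    ≡⟨ ℕ.+-comm s′ (toℕ t + ℓ) ⟩
      toℕ t + ℓ + s′      ≡⟨ cong₂ _+_ u≡t+ℓ (ℕ.*-identityˡ s′) ⟨
      toℕ u + 1 * s′      ∎

%-injective-window : ∀ {d} .{{_ : NonZero d}} {x y} → x ≤ y → y < x + d → x % d ≡ y % d → x ≡ y
%-injective-window {d} {x} {y} x≤y y<x+d x%d≡y%d = by-quotient (y / d ∸ x / d) y∸x≡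
  where
  open ≡-Reasoning
  y∸x≡ : y ∸ x ≡ (y / d ∸ x / d) * d
  y∸x≡ = begin
    y ∸ x
      ≡⟨ cong₂ _∸_ (m≡m%n+[m/n]*n y d) (m≡m%n+[m/n]*n x d) ⟩
    (y % d + y / d * d) ∸ (x % d + x / d * d)
      ≡⟨ cong (λ r → (r + y / d * d) ∸ (x % d + x / d * d)) (sym x%d≡y%d) ⟩
    (x % d + y / d * d) ∸ (x % d + x / d * d)
      ≡⟨ ℕ.[m+n]∸[m+o]≡n∸o (x % d) (y / d * d) (x / d * d) ⟩
    y / d * d ∸ x / d * d
      ≡⟨ ℕ.*-distribʳ-∸ d (y / d) (x / d) ⟨
    (y / d ∸ x / d) * d ∎
  by-quotient : ∀ q → y ∸ x ≡ q * d → x ≡ y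
  by-quotient zero    y∸x≡0  = ℕ.≤-antisym x≤y (ℕ.m∸n≡0⇒m≤n y∸x≡0)
  by-quotient (suc q) y∸x≡qd = contradiction (subst (d ≤_) (sym y∸x≡qd) (ℕ.m≤m+n d (q * d)))
    (ℕ.<⇒≱ (subst (y ∸ x <_) (ℕ.m+n∸m≡n x d) (ℕ.∸-monoˡ-< y<x+d x≤y)))

rotate : ∀ {s} → ℕ → Fin (suc s) → Fin (suc s)
rotate {s} c t = (toℕ t + c) mod suc s

rotate-injective : ∀ {s} c → Injective _≡_ _≡_ (rotate {s} c)
rotate-injective {s} c {t} {u} rt≡ru = toℕ-injective (by-order (ℕ.≤-total (toℕ t) (toℕ u)))
  where
  remainders : (toℕ t + c) % suc s ≡ (toℕ u + c) % suc s
  remainders = trans (sym (toℕ-fromℕ< _)) (trans (cong toℕ rt≡ru) (toℕ-fromℕ< _))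
  window : ∀ {v w : Fin (suc s)} → toℕ v ≤ toℕ w →
           (toℕ v + c) % suc s ≡ (toℕ w + c) % suc s → toℕ v ≡ toℕ w
  window {v} {w} v≤w v+c≡w+c = ℕ.+-cancelʳ-≡ c (toℕ v) (toℕ w)
    (%-injective-window (ℕ.+-monoˡ-≤ c v≤w) w+c<v+c+s v+c≡w+c)
    where
    open ℕ.≤-Reasoning
    w+c<v+c+s : toℕ w + c < toℕ v + c + suc s
    w+c<v+c+s = begin-strict
      toℕ w + c         <⟨ ℕ.+-monoˡ-< c (toℕ<n w) ⟩
      suc s + c         ≡⟨ ℕ.+-comm (suc s) c ⟩
      c + suc s         ≤⟨ ℕ.+-monoˡ-≤ (suc s) (ℕ.m≤n+m c (toℕ v)) ⟩
      toℕ v + c + suc s ∎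
  by-order : toℕ t ≤ toℕ u ⊎ toℕ u ≤ toℕ t → toℕ t ≡ toℕ u
  by-order (inj₁ t≤u) = window t≤u remainders
  by-order (inj₂ u≤t) = sym (window u≤t (sym remainders))

-- The rotated submatrix

increasing⇒injective : ∀ {s n} {a : Fin s → Fin n} → StrictlyIncreasing a → Injective _≡_ _≡_ a
increasing⇒injective increasing {t} {u} aₜ≡aᵤ with Fin.<-cmp t u
... | tri< t<u _ _ = contradiction (cong toℕ aₜ≡aᵤ) (ℕ.<⇒≢ (increasing t u t<u))
... | tri≈ _ t≡u _ = t≡u
... | tri> _ _ u<t = contradiction (cong toℕ (sym aₜ≡aᵤ)) (ℕ.<⇒≢ (increasing u t u<t))

submatrix-distinct : ∀ {s n} {a b : Fin s → Fin n} → StrictlyIncreasing a → StrictlyIncreasing b →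
                     DistinctEntries (submatrix a b)
submatrix-distinct a-increasing b-increasing aᵣb꜀≡aᵣ′b꜀′ =
  increasing⇒injective a-increasing (cong proj₁ aᵣb꜀≡aᵣ′b꜀′) ,
  increasing⇒injective b-increasing (cong proj₂ aᵣb꜀≡aᵣ′b꜀′)

module RotatedSubmatrix {k s} {a b : Fin (suc s) → Fin (suc k)}
  (a-increasing : StrictlyIncreasing a) (b-increasing : StrictlyIncreasing b)
  {ℓ} (shift : IsShift a b ℓ) where

  s′ : ℕ
  s′ = suc s

  T : Fin s′
  T = proj₁ (shift-cut a-increasing shift)

  ρ γ : Permutation′ s′
  ρ = injective⇒permutation (rotate-injective (toℕ T + ℓ))
  γ = injective⇒permutation (rotate-injective (toℕ T))

  E : Matrix (suc k) s′
  E = reindex (submatrix a b) ρ γ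

  α β : Fin s′ → ℕ
  α i = unroll a (toℕ i + (toℕ T + ℓ))
  β j = unroll b (toℕ j + toℕ T)

  α-increasing : ∀ {i r} → i Fin.< r → α i < α r
  α-increasing i<r = unroll-increasing a a-increasing (ℕ.+-monoˡ-< (toℕ T + ℓ) i<r)

  β-increasing : ∀ {c i} → c Fin.< i → β c < β i
  β-increasing c<i = unroll-increasing b b-increasing (ℕ.+-monoˡ-< (toℕ T) c<i)

  α-monotone : ∀ {i r} → i Fin.≤ r → α i ≤ α r
  α-monotone i≤r = unroll-monotone a a-increasing (ℕ.+-monoˡ-≤ (toℕ T + ℓ) i≤r)

  β-monotone : ∀ {c i} → c Fin.≤ i → β c ≤ β i
  β-monotone c≤i = unroll-monotone b b-increasing (ℕ.+-monoˡ-≤ (toℕ T) c≤i)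

  β<α : ∀ i → β i < α i
  β<α i = subst (λ x → β i < unroll a x) (ℕ.+-assoc (toℕ i) (toℕ T) ℓ)
                (unroll-shift a-increasing (proj₁ (proj₂ shift)) (toℕ i + toℕ T))

  α≤1+k+β : ∀ r c → α r ≤ suc k + β c
  α≤1+k+β r c = begin
    α r                ≤⟨ proj₂ (shift-cut a-increasing shift) (toℕ r) (toℕ<n r) ⟩
    suc k + toℕ (b T)  ≡⟨ cong (λ e → suc k + e) (unroll-fin b T) ⟨
    suc k + β Fin.zero ≤⟨ ℕ.+-monoʳ-≤ (suc k) (β-monotone {c = Fin.zero} {c} z≤n) ⟩
    suc k + β c        ∎
    where open ℕ.≤-Reasoning

  offset : Fin s′ → Fin s′ → ℕ
  offset r c = suc k + β c ∸ α r

  φ-E : ∀ r c → β c < α r → φᵛ (E r c) ≡ suc (offset r c * suc k + (k ∸ toℕ (b (γ ⟨$⟩ʳ c))))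
  φ-E r c βc<αr = φ-offset (a (ρ ⟨$⟩ʳ r)) (b (γ ⟨$⟩ʳ c))
    {x = (toℕ r + (toℕ T + ℓ)) / s′} {y = suc ((toℕ c + toℕ T) / s′)} offset<1+k (begin
      offset r c + toℕ (a (ρ ⟨$⟩ʳ r)) + (toℕ r + (toℕ T + ℓ)) / s′ * suc k
        ≡⟨ ℕ.+-assoc (offset r c) _ _ ⟩
      offset r c + α r
        ≡⟨ ℕ.m∸n+n≡m (α≤1+k+β r c) ⟩
      suc k + β c
        ≡⟨ x∙yz≈y∙xz (suc k) (toℕ (b (γ ⟨$⟩ʳ c))) _ ⟩
      toℕ (b (γ ⟨$⟩ʳ c)) + suc ((toℕ c + toℕ T) / s′) * suc k ∎)
    where
    open ≡-Reasoning
    offset<1+k : offset r c < suc k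
    offset<1+k = subst (offset r c <_) (ℕ.m+n∸n≡m (suc k) (β c)) (ℕ.∸-monoʳ-< βc<αr (α≤1+k+β r c))

  southWest : ∀ {i r c} → i Fin.≤ r → c Fin.≤ i → (r , c) ≢ (i , i) → φᵛ (E r c) < φᵛ (E i i)
  southWest {i} {r} {c} i≤r c≤i rc≢ii =
    subst₂ _<_ (sym (φ-E r c βc<αr)) (sym (φ-E i i (β<α i)))
      (s≤s (digits-< (s≤s (ℕ.m∸n≤m k (toℕ (b (γ ⟨$⟩ʳ c))))) offset-decreases))
    where
    βc<αr : β c < α r
    βc<αr = ℕ.≤-<-trans (β-monotone c≤i) (ℕ.<-≤-trans (β<α i) (α-monotone i≤r))
    offset-decreases : offset r c < offset i i
    offset-decreases with r Fin.≟ i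
    ... | no r≢i = begin-strict
      suc k + β c ∸ α r ≤⟨ ℕ.∸-monoˡ-≤ (α r) (ℕ.+-monoʳ-≤ (suc k) (β-monotone c≤i)) ⟩
      suc k + β i ∸ α r <⟨ ℕ.∸-monoʳ-< (α-increasing (ℕ.≤∧≢⇒< i≤r (r≢i ∘ sym ∘ toℕ-injective)))
                                        (α≤1+k+β r i) ⟩
      suc k + β i ∸ α i ∎
      where open ℕ.≤-Reasoning
    ... | yes refl = ℕ.∸-monoˡ-<
      (ℕ.+-monoʳ-< (suc k) (β-increasing (ℕ.≤∧≢⇒< c≤i λ c≡r → rc≢ii (cong (r ,_) (toℕ-injective c≡r)))))
      (α≤1+k+β r c)

  N-diagonal : InN a b ℓ (E Fin.zero Fin.zero)
  N-diagonal = γ ⟨$⟩ʳ Fin.zero , ρ ⟨$⟩ʳ Fin.zero , toℕρ₀≡[γ₀+ℓ]%s′ , refl , refl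
    where
    toℕγ₀≡T : toℕ (γ ⟨$⟩ʳ Fin.zero) ≡ toℕ T
    toℕγ₀≡T = trans (toℕ-fromℕ< _) (m<n⇒m%n≡m (toℕ<n T))
    toℕρ₀≡[γ₀+ℓ]%s′ : toℕ (ρ ⟨$⟩ʳ Fin.zero) ≡ (toℕ (γ ⟨$⟩ʳ Fin.zero) + ℓ) % s′
    toℕρ₀≡[γ₀+ℓ]%s′ = trans (toℕ-fromℕ< _) (cong (λ t → (t + ℓ) % s′) (sym toℕγ₀≡T))

lemma7p5 : ∀ {c ℓ} (K : Field c ℓ) (n s : ℕ)
    (a b : Fin (suc s) → Fin n) →
    StrictlyIncreasing a → StrictlyIncreasing b →
    (l : ℕ) → IsShift a b l →
    ∃ λ (m : Monomial n) →
      Poly.IsLeadingMonomial K (Poly.det K (suc s) (submatrix a b)) m ×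
      ∃ λ (p : Fin n × Fin n) → InN a b l p × p ∣M m
lemma7p5 K zero    s a b _ _ _ _ = ⊥-elim (Fin.¬Fin0 (a Fin.zero))
lemma7p5 K (suc k) s a b a-increasing b-increasing l shift =
  diagonal E ,
  Coefficients.leading-transversal K distinct (diagonal-transversal distinct ρ γ)
    (transversal-⪯-diagonal (reindex-distinct distinct ρ γ) southWest
      ∘ transversal-reindex distinct ρ γ) ,
  E Fin.zero Fin.zero , N-diagonal , prodVars-∈⇒pos (λ i → E i i) Fin.zero refl
  where
  open RotatedSubmatrix a-increasing b-increasing shift
  distinct : DistinctEntries (submatrix a b)
  distinct = submatrix-distinct a-increasing b-increasing
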